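{- Let $m,n\ge 1$, $H\subseteq\{0,\dots,m-1\}$ and $V\subseteq\{1,\dots,n\}$ with $0\in H$ and $1\in V$, and let $H'=H\setminus\{0\}$, $V'=V\setminus\{1\}$. Then there is a bijection $\phi:\mathcal P_{m,n}\to\mathcal P_{m,n}$ such that for every path $p$, $\mathrm{CORNERS}^{(H',V')}(\phi(p))=\mathrm{CORNERS}^{(H,V)}(p)-1$ and $\mathrm{CINDEX}^{(H',V')}(\phi(p))=\mathrm{CINDEX}^{(H,V)}(p)-1$.
   Context: The grid $G_{m,n}$ has nodes $(i,j)$, $0\le i\le m$ (row, downward), $0\le j\le n$ (column, rightward). $\mathcal P_{m,n}$ is the set of lattice paths from $(0,0)$ to $(m,n)$ with unit down and right steps. A true corner is a node where a right step is immediately followed by a down step. For a pair $(H,V)$ with $H\subseteq\{0,\dots,m-1\}$, $V\subseteq\{1,\dots,n\}$, each $h\in H$ marks the node of the path on row $h$ from which it steps down to row $h+1$, and each $v\in V$ marks the node reached by the path's $v$-th right step. $\mathrm{CORNERS}^{(H,V)}(p)$ is the number of nodes that are true corners or marked (each node counted once), and $\mathrm{CINDEX}^{(H,V)}(p)$ is the sum of $i+j$ over these nodes $(i,j)$. -}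

module Defs where

open import Data.Nat using (ℕ; zero; suc; _+_; _≡ᵇ_)
open import Data.Bool using (Bool; true; false; _∧_; _∨_)
open import Data.List using (List; []; _∷_; length; map; filter)
open import Data.Bool.ListAction using (any)
open import Data.Nat.ListAction using (sum)
open import Data.Bool.Base using (not; T)
open import Relation.Nullary.Decidable using (T?)
open import Data.Maybe using (Maybe; just; nothing)
open import Data.Product using (Σ; _×_; _,_; proj₁)
open import Relation.Binary.PropositionalEquality using (_≡_)

data Step : Set where
  down right : Step

isDown : Step → Bool
isDown down = true
isDown right = false

isRight : Step → Bool
isRight down = false
isRight right = true

countDown : List Step → ℕ
countDown [] = 0
countDown (down ∷ w) = suc (countDown w)
countDown (right ∷ w) = countDown w

countRight : List Step → ℕ
countRight [] = 0
countRight (down ∷ w) = countRight w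
countRight (right ∷ w) = suc (countRight w)

-- 𝓟_{m,n}: lattice paths from (0,0) to (m,n) with unit down / right steps,
-- given by their step word (m down steps and n right steps).
Path : ℕ → ℕ → Set
Path m n = Σ (List Step) (λ w → (countDown w ≡ m) × (countRight w ≡ n))

_∈ᵇ_ : ℕ → List ℕ → Bool
x ∈ᵇ xs = any (λ y → x ≡ᵇ y) xs

prevRight : Maybe Step → Bool
prevRight (just right) = true
prevRight _ = false

-- A node is collected
-- iff it is a true corner (right step followed by a down step), or it is the
-- node of row i from which the path steps down with i ∈ H, or it is the node
-- reached by the j-th right step with j ∈ V.  Each node is visited once, so
-- each node is collected at most once.
markedFrom : List ℕ → List ℕ → ℕ → ℕ → Maybe Step → List Step → List (ℕ × ℕ)
markedFrom H V i j prev [] =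
  if' (prevRight prev ∧ (j ∈ᵇ V)) (i , j) []
  where
    if' : Bool → ℕ × ℕ → List (ℕ × ℕ) → List (ℕ × ℕ)
    if' true x xs = x ∷ xs
    if' false x xs = xs
markedFrom H V i j prev (s ∷ w) =
  if' ((prevRight prev ∧ isDown s) ∨ (isDown s ∧ (i ∈ᵇ H)) ∨ (prevRight prev ∧ (j ∈ᵇ V)))
      (i , j) (markedFrom H V (next-i s) (next-j s) (just s) w)
  where
    if' : Bool → ℕ × ℕ → List (ℕ × ℕ) → List (ℕ × ℕ)
    if' true x xs = x ∷ xs
    if' false x xs = xs
    next-i : Step → ℕ
    next-i down = suc i
    next-i right = i
    next-j : Step → ℕ
    next-j down = j
    next-j right = suc j

markedNodes : ∀ {m n} → List ℕ → List ℕ → Path m n → List (ℕ × ℕ)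
markedNodes H V p = markedFrom H V 0 0 nothing (proj₁ p)

CORNERS : ∀ {m n} → List ℕ → List ℕ → Path m n → ℕ
CORNERS H V p = length (markedNodes H V p)

CINDEX : ∀ {m n} → List ℕ → List ℕ → Path m n → ℕ
CINDEX H V p = sum (map (λ { (i , j) → i + j }) (markedNodes H V p))

remove : ℕ → List ℕ → List ℕ
remove x xs = filter (λ y → T? (not (x ≡ᵇ y))) xs

-- Write a path as D^k R D^j followed by a tail that is empty or starts with its second right
-- step.  Removing 0 from H and 1 from V changes no mark on the tail (its nodes lie right of
-- column 1, and those of row 0 that step down are corners anyway), so it suffices to permute,
-- for each s, the prefixes with k + j = s and keep the tail.  Both statistics are sums of
-- α + β (i + j) over the marked nodes.  Passing from s to s + 1 lengthens the prefix by one
-- down step, which changes its weight by an amount depending only on whether s ∈ H;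
-- accordingly the permutation of {0, …, s} is built as σ (s + 1) = σ s ∘ (s  s+1) when s ∈ H
-- and (s  s+1) ∘ σ s otherwise, and an induction on s shows that the weight of prefix σ s k
-- under (H′ , V′) plus α + β is the weight of prefix k under (H , V).
module Submission where

open import Defs
open import Data.Nat using (ℕ; zero; suc; _+_; _*_; _∸_; _≤_; _<_; s≤s; _≤?_; _≡ᵇ_)
open import Data.Nat.Properties
open import Data.Nat.ListAction using (sum)
open import Data.Nat.ListAction.Properties using (sum-++)
open import Data.Nat.Tactic.RingSolver using (solve-∀)
open import Data.Bool using (Bool; true; false; not; T; _∨_)
open import Data.Bool.Properties using (T-≡)
open import Data.List using (List; []; _∷_; _++_; length; map)
open import Data.List.Properties using (map-++; ++-assoc)
open import Data.List.Relation.Unary.All using (All)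
open import Data.List.Relation.Unary.Any as Any using ()
open import Data.List.Relation.Unary.Any.Properties using (any⁺)
open import Data.List.Membership.Propositional using (_∈_)
open import Data.Maybe using (Maybe; just; nothing)
open import Data.Product using (Σ; _×_; _,_; proj₁; proj₂; map₁)
open import Data.Sum using (_⊎_; inj₁; inj₂)
open import Function.Bundles using (_⤖_; Bijection; _↔_; Inverse; Equivalence; mk↔ₛ′)
open import Function.Construct.Composition using (_↔-∘_)
open import Function.Construct.Identity using (↔-id)
open import Function.Construct.Symmetry using (↔-sym)
open import Function.Properties.Inverse using (↔⇒⤖)
open import Relation.Nullary using (¬_; yes; no; contradiction)
open import Relation.Binary.PropositionalEquality

downs : ℕ → List Step
downs zero = []
downs (suc k) = down ∷ downs k

-- A word either never turns right (inj₁ k: D^k), or is D^k R D^j followed by nothing or by R u.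
Shape : Set
Shape = ℕ ⊎ ((ℕ × ℕ) × Maybe (List Step))

rest : Maybe (List Step) → List Step
rest nothing = []
rest (just u) = right ∷ u

word : Shape → List Step
word (inj₁ k) = downs k
word (inj₂ ((k , j) , t)) = downs k ++ right ∷ downs j ++ rest t

firstColumn : List Step → ℕ × Maybe (List Step)
firstColumn [] = 0 , nothing
firstColumn (down ∷ w) = map₁ suc (firstColumn w)
firstColumn (right ∷ w) = 0 , just w

shape : List Step → Shape
shape [] = inj₁ 0
shape (down ∷ w) with shape w
... | inj₁ k = inj₁ (suc k)
... | inj₂ ((k , j) , t) = inj₂ ((suc k , j) , t)
shape (right ∷ w) = inj₂ ((0 , proj₁ (firstColumn w)) , proj₂ (firstColumn w))

firstColumn-downs : ∀ j t → firstColumn (downs j ++ rest t) ≡ (j , t)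
firstColumn-downs zero nothing = refl
firstColumn-downs zero (just u) = refl
firstColumn-downs (suc j) t rewrite firstColumn-downs j t = refl

shape-word : ∀ x → shape (word x) ≡ x
shape-word (inj₁ zero) = refl
shape-word (inj₁ (suc k)) rewrite shape-word (inj₁ k) = refl
shape-word (inj₂ ((zero , j) , t)) rewrite firstColumn-downs j t = refl
shape-word (inj₂ ((suc k , j) , t)) rewrite shape-word (inj₂ ((k , j) , t)) = refl

word-firstColumn : ∀ w → downs (proj₁ (firstColumn w)) ++ rest (proj₂ (firstColumn w)) ≡ w
word-firstColumn [] = refl
word-firstColumn (down ∷ w) = cong (down ∷_) (word-firstColumn w)
word-firstColumn (right ∷ w) = refl

word-shape : ∀ w → word (shape w) ≡ w
word-shape [] = refl
word-shape (down ∷ w) with shape w | word-shape w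
... | inj₁ k | eq = cong (down ∷_) eq
... | inj₂ ((k , j) , t) | eq = cong (down ∷_) eq
word-shape (right ∷ w) = cong (right ∷_) (word-firstColumn w)

word↔ : Shape ↔ List Step
word↔ = mk↔ₛ′ word shape word-shape shape-word

mapTurn↔ : ((ℕ × ℕ) ↔ (ℕ × ℕ)) → Shape ↔ Shape
mapTurn↔ π = mk↔ₛ′ (move (Inverse.to π)) (move (Inverse.from π))
  (cancel (Inverse.strictlyInverseˡ π)) (cancel (Inverse.strictlyInverseʳ π))
  where
  move : (ℕ × ℕ → ℕ × ℕ) → Shape → Shape
  move f (inj₁ k) = inj₁ k
  move f (inj₂ (p , t)) = inj₂ (f p , t)
  cancel : ∀ {f g} → (∀ p → f (g p) ≡ p) → ∀ x → move f (move g x) ≡ x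
  cancel fg (inj₁ k) = refl
  cancel fg (inj₂ (p , t)) = cong (λ q → inj₂ (q , t)) (fg p)

reshape : ((ℕ × ℕ) ↔ (ℕ × ℕ)) → List Step ↔ List Step
reshape π = word↔ ↔-∘ (mapTurn↔ π ↔-∘ ↔-sym word↔)

countDown-word : ∀ k j t → countDown (word (inj₂ ((k , j) , t))) ≡ k + j + countDown (rest t)
countDown-word (suc k) j t = cong suc (countDown-word k j t)
countDown-word zero zero t = refl
countDown-word zero (suc j) t = cong suc (countDown-word zero j t)

countRight-word : ∀ k j t → countRight (word (inj₂ ((k , j) , t))) ≡ suc (countRight (rest t))
countRight-word (suc k) j t = countRight-word k j t
countRight-word zero zero t = refl
countRight-word zero (suc j) t = countRight-word zero j t

CountPreserving : (List Step → List Step) → Set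
CountPreserving f = ∀ w → countDown (f w) ≡ countDown w × countRight (f w) ≡ countRight w

reshape-counts : (π : (ℕ × ℕ) ↔ (ℕ × ℕ)) →
                 (∀ k j → proj₁ (Inverse.to π (k , j)) + proj₂ (Inverse.to π (k , j)) ≡ k + j) →
                 CountPreserving (Inverse.to (reshape π))
reshape-counts π diagonal w with shape w | word-shape w
... | inj₁ k | refl = refl , refl
... | inj₂ ((k , j) , t) | refl =
  trans (countDown-word k′ j′ t) (trans (cong (_+ countDown (rest t)) (diagonal k j)) (sym (countDown-word k j t))) ,
  trans (countRight-word k′ j′ t) (sym (countRight-word k j t))
  where
  k′ j′ : ℕ
  k′ = proj₁ (Inverse.to π (k , j))
  j′ = proj₂ (Inverse.to π (k , j))

path-≡ : ∀ {m n} {p q : Path m n} → proj₁ p ≡ proj₁ q → p ≡ q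
path-≡ {p = w , a , b} {q = .w , c , d} refl = cong₂ (λ x y → w , x , y) (≡-irrelevant a c) (≡-irrelevant b d)

onPaths : ∀ {m n} (f : List Step ↔ List Step) → CountPreserving (Inverse.to f) → Path m n ↔ Path m n
onPaths f preserves = mk↔ₛ′ (along (Inverse.to f) preserves) (along (Inverse.from f) preserved⁻¹)
  (λ p → path-≡ (Inverse.strictlyInverseˡ f (proj₁ p)))
  (λ p → path-≡ (Inverse.strictlyInverseʳ f (proj₁ p)))
  where
  along : ∀ {m n} (g : List Step → List Step) → CountPreserving g → Path m n → Path m n
  along g pres (w , d , r) = g w , trans (proj₁ (pres w)) d , trans (proj₂ (pres w)) r
  preserved⁻¹ : CountPreserving (Inverse.from f)
  preserved⁻¹ w = let d , r = preserves (Inverse.from f w) ; back = Inverse.strictlyInverseˡ f w in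
    trans (sym d) (cong countDown back) , trans (sym r) (cong countRight back)

transposeSuc : ℕ → ℕ → ℕ
transposeSuc zero zero = 1
transposeSuc zero (suc zero) = 0
transposeSuc zero (suc (suc x)) = suc (suc x)
transposeSuc (suc a) zero = zero
transposeSuc (suc a) (suc x) = suc (transposeSuc a x)

transposeSuc-involutive : ∀ a x → transposeSuc a (transposeSuc a x) ≡ x
transposeSuc-involutive zero zero = refl
transposeSuc-involutive zero (suc zero) = refl
transposeSuc-involutive zero (suc (suc x)) = refl
transposeSuc-involutive (suc a) zero = refl
transposeSuc-involutive (suc a) (suc x) = cong suc (transposeSuc-involutive a x)

transposeSuc-self : ∀ a → transposeSuc a a ≡ suc a
transposeSuc-self zero = refl
transposeSuc-self (suc a) = cong suc (transposeSuc-self a)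

transposeSuc-suc : ∀ a → transposeSuc a (suc a) ≡ a
transposeSuc-suc zero = refl
transposeSuc-suc (suc a) = cong suc (transposeSuc-suc a)

transposeSuc-below : ∀ {a x} → x < a → transposeSuc a x ≡ x
transposeSuc-below {suc a} {zero} _ = refl
transposeSuc-below {suc a} {suc x} (s≤s x<a) = cong suc (transposeSuc-below x<a)

transposeSuc-above : ∀ {a x} → suc a < x → transposeSuc a x ≡ x
transposeSuc-above {zero} {suc zero} (s≤s ())
transposeSuc-above {zero} {suc (suc x)} _ = refl
transposeSuc-above {suc a} {suc x} (s≤s a<x) = cong suc (transposeSuc-above a<x)

transposeSuc↔ : ℕ → ℕ ↔ ℕ
transposeSuc↔ a = mk↔ₛ′ (transposeSuc a) (transposeSuc a) (transposeSuc-involutive a) (transposeSuc-involutive a)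

FixesAbove : ℕ → ℕ ↔ ℕ → Set
FixesAbove s π = ∀ x → s < x → Inverse.to π x ≡ x

FixesAbove-sym : ∀ {s} π → FixesAbove s π → FixesAbove s (↔-sym π)
FixesAbove-sym π fixes x s<x =
  trans (cong (Inverse.from π) (sym (fixes x s<x))) (Inverse.strictlyInverseʳ π x)

FixesAbove⇒bounded : ∀ {s} π → FixesAbove s π → ∀ x → x ≤ s → Inverse.to π x ≤ s
FixesAbove⇒bounded {s} π fixes x x≤s with Inverse.to π x ≤? s
... | yes πx≤s = πx≤s
... | no πx≰s = contradiction (subst (_≤ s) πx≡x x≤s) πx≰s
  where
  πx≡x : x ≡ Inverse.to π x
  πx≡x = trans (sym (Inverse.strictlyInverseʳ π x))
    (trans (cong (Inverse.from π) (sym (fixes _ (≰⇒> πx≰s)))) (Inverse.strictlyInverseʳ π _))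

antidiagonal : (ℕ → ℕ ↔ ℕ) → ℕ × ℕ → ℕ × ℕ
antidiagonal π (k , j) = Inverse.to (π (k + j)) k , k + j ∸ Inverse.to (π (k + j)) k

antidiagonal-sum : ∀ π → (∀ s → FixesAbove s (π s)) → ∀ k j →
                   proj₁ (antidiagonal π (k , j)) + proj₂ (antidiagonal π (k , j)) ≡ k + j
antidiagonal-sum π fixes k j = m+[n∸m]≡n (FixesAbove⇒bounded (π (k + j)) (fixes (k + j)) k (m≤m+n k j))

antidiagonal-cancel : ∀ π ρ → (∀ s → FixesAbove s (π s)) →
                      (∀ s x → Inverse.to (ρ s) (Inverse.to (π s) x) ≡ x) →
                      ∀ p → antidiagonal ρ (antidiagonal π p) ≡ p
antidiagonal-cancel π ρ fixes cancel (k , j)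
  rewrite antidiagonal-sum π fixes k j | cancel (k + j) k | m+n∸m≡n k j = refl

antidiagonal↔ : (π : ℕ → ℕ ↔ ℕ) → (∀ s → FixesAbove s (π s)) → (ℕ × ℕ) ↔ (ℕ × ℕ)
antidiagonal↔ π fixes = mk↔ₛ′ (antidiagonal π) (antidiagonal (λ s → ↔-sym (π s)))
  (antidiagonal-cancel (λ s → ↔-sym (π s)) π (λ s → FixesAbove-sym (π s) (fixes s))
    (λ s → Inverse.strictlyInverseˡ (π s)))
  (antidiagonal-cancel π (λ s → ↔-sym (π s)) fixes (λ s → Inverse.strictlyInverseʳ (π s)))

extend : Bool → ℕ → ℕ ↔ ℕ → ℕ ↔ ℕ
extend true s π = π ↔-∘ transposeSuc↔ s
extend false s π = transposeSuc↔ s ↔-∘ π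

shuffle : List ℕ → ℕ → ℕ ↔ ℕ
shuffle H zero = ↔-id ℕ
shuffle H (suc s) = extend (s ∈ᵇ H) s (shuffle H s)

shuffle-fixes : ∀ H s → FixesAbove s (shuffle H s)
shuffle-fixes H zero x _ = refl
shuffle-fixes H (suc s) x s+1<x with s ∈ᵇ H
... | true rewrite transposeSuc-above s+1<x = shuffle-fixes H s x (<⇒≤ s+1<x)
... | false rewrite shuffle-fixes H s x (<⇒≤ s+1<x) = transposeSuc-above s+1<x

∈ᵇ-complete : ∀ {x L} → x ∈ L → (x ∈ᵇ L) ≡ true
∈ᵇ-complete {x} x∈L = Equivalence.to T-≡ (any⁺ _ (Any.map (λ { refl → ≡⇒≡ᵇ x x refl }) x∈L))

∈ᵇ-remove-self : ∀ y L → (y ∈ᵇ remove y L) ≡ false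
∈ᵇ-remove-self y [] = refl
∈ᵇ-remove-self y (z ∷ L) with y ≡ᵇ z in eq
... | true = ∈ᵇ-remove-self y L
... | false rewrite eq = ∈ᵇ-remove-self y L

∈ᵇ-remove-other : ∀ {x y} L → ¬ x ≡ y → (x ∈ᵇ remove y L) ≡ (x ∈ᵇ L)
∈ᵇ-remove-other [] x≢y = refl
∈ᵇ-remove-other {x} {y} (z ∷ L) x≢y with y ≡ᵇ z in eq
... | true with ≡ᵇ⇒≡ y z (subst T (sym eq) _)
...   | refl with x ≡ᵇ y in eq′
...     | true = contradiction (≡ᵇ⇒≡ x y (subst T (sym eq′) _)) x≢y
...     | false = ∈ᵇ-remove-other L x≢y
∈ᵇ-remove-other {x} (z ∷ L) x≢y | false = cong ((x ≡ᵇ z) ∨_) (∈ᵇ-remove-other L x≢y)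

consIf : {A : Set} → Bool → A → List A → List A
consIf true x xs = x ∷ xs
consIf false x xs = xs

columnMarks : List ℕ → ℕ → ℕ → ℕ → List (ℕ × ℕ)
columnMarks H c i zero = []
columnMarks H c i (suc r) = consIf (i ∈ᵇ H) (i , c) (columnMarks H c (suc i) r)

consIf-++ : {A : Set} (b : Bool) (x : A) (xs ys : List A) → consIf b x xs ++ ys ≡ consIf b x (xs ++ ys)
consIf-++ true x xs ys = refl
consIf-++ false x xs ys = refl

columnMarks-snoc : ∀ H c i r →
  columnMarks H c i (suc r) ≡ columnMarks H c i r ++ consIf ((i + r) ∈ᵇ H) (i + r , c) []
columnMarks-snoc H c i zero rewrite +-identityʳ i = refl
columnMarks-snoc H c i (suc r) rewrite columnMarks-snoc H c (suc i) r | +-suc i r =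
  sym (consIf-++ (i ∈ᵇ H) (i , c) (columnMarks H c (suc i) r) _)

columnMarks-rows : ∀ {H H′} → (∀ i → (suc i ∈ᵇ H) ≡ (suc i ∈ᵇ H′)) →
                   ∀ c i r → columnMarks H c (suc i) r ≡ columnMarks H′ c (suc i) r
columnMarks-rows rows c i zero = refl
columnMarks-rows rows c i (suc r) = cong₂ (λ b xs → consIf b (suc i , c) xs) (rows i) (columnMarks-rows rows c (suc i) r)

-- b says whether 1 ∈ V: the node reached by the first right step is marked iff it is a corner or b holds.
cornerMarks : List ℕ → Bool → ℕ → ℕ → List (ℕ × ℕ)
cornerMarks H b k zero = consIf b (k , 1) []
cornerMarks H b k (suc j) = (k , 1) ∷ columnMarks H 1 (suc k) j

prefixMarks : List ℕ → Bool → ℕ → ℕ → List (ℕ × ℕ)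
prefixMarks H b k j = columnMarks H 0 0 k ++ cornerMarks H b k j

tailMarks : List ℕ → List ℕ → ℕ → Maybe (List Step) → List (ℕ × ℕ)
tailMarks H V i nothing = []
tailMarks H V i (just u) = markedFrom H V i 2 (just right) u

markedFrom-start : ∀ H V i c w → markedFrom H V i c nothing w ≡ markedFrom H V i c (just down) w
markedFrom-start H V i c [] = refl
markedFrom-start H V i c (s ∷ w) = refl

markedFrom-downs : ∀ H V i c r t →
  markedFrom H V i c (just down) (downs r ++ t) ≡ columnMarks H c i r ++ markedFrom H V (i + r) c (just down) t
markedFrom-downs H V i c zero t = cong (λ i′ → markedFrom H V i′ c (just down) t) (sym (+-identityʳ i))
markedFrom-downs H V i c (suc r) t rewrite markedFrom-downs H V (suc i) c r t | +-suc i r with i ∈ᵇ H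
... | true = refl
... | false = refl

markedFrom-rest : ∀ H V i t → markedFrom H V i 1 (just down) (rest t) ≡ tailMarks H V i t
markedFrom-rest H V i nothing = refl
markedFrom-rest H V i (just u) = refl

markedFrom-corner : ∀ H V k j t →
  markedFrom H V k 1 (just right) (downs j ++ rest t) ≡ cornerMarks H (1 ∈ᵇ V) k j ++ tailMarks H V (k + j) t
markedFrom-corner H V k zero nothing with 1 ∈ᵇ V
... | true = refl
... | false = refl
markedFrom-corner H V k zero (just u) rewrite +-identityʳ k with 1 ∈ᵇ V
... | true = refl
... | false = refl
markedFrom-corner H V k (suc j) t rewrite +-suc k j =
  cong ((k , 1) ∷_) (trans (markedFrom-downs H V (suc k) 1 j (rest t))
    (cong (columnMarks H 1 (suc k) j ++_) (markedFrom-rest H V (suc k + j) t)))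

markedFrom-word : ∀ H V k j t →
  markedFrom H V 0 0 nothing (word (inj₂ ((k , j) , t))) ≡ prefixMarks H (1 ∈ᵇ V) k j ++ tailMarks H V (k + j) t
markedFrom-word H V k j t = begin
  markedFrom H V 0 0 nothing (downs k ++ right ∷ downs j ++ rest t)
    ≡⟨ markedFrom-start H V 0 0 (downs k ++ right ∷ downs j ++ rest t) ⟩
  markedFrom H V 0 0 (just down) (downs k ++ right ∷ downs j ++ rest t)
    ≡⟨ markedFrom-downs H V 0 0 k (right ∷ downs j ++ rest t) ⟩
  columnMarks H 0 0 k ++ markedFrom H V k 1 (just right) (downs j ++ rest t)
    ≡⟨ cong (columnMarks H 0 0 k ++_) (markedFrom-corner H V k j t) ⟩
  columnMarks H 0 0 k ++ cornerMarks H (1 ∈ᵇ V) k j ++ tailMarks H V (k + j) t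
    ≡⟨ sym (++-assoc (columnMarks H 0 0 k) _ _) ⟩
  prefixMarks H (1 ∈ᵇ V) k j ++ tailMarks H V (k + j) t ∎
  where open ≡-Reasoning

-- Positions from which on the marks no longer depend on row 0 of H or column 1 of V.
data Interior : ℕ → ℕ → Maybe Step → Set where
  afterDown  : ∀ i j → Interior (suc i) (suc j) (just down)
  afterRight : ∀ i j → Interior i (suc (suc j)) (just right)

module _ {H H′ V V′ : List ℕ}
         (rows : ∀ i → (suc i ∈ᵇ H) ≡ (suc i ∈ᵇ H′))
         (columns : ∀ j → (suc (suc j) ∈ᵇ V) ≡ (suc (suc j) ∈ᵇ V′)) where

  markedFrom-interior : ∀ {i j prev} → Interior i j prev →
                        ∀ w → markedFrom H V i j prev w ≡ markedFrom H′ V′ i j prev w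
  markedFrom-interior (afterDown i j) [] = refl
  markedFrom-interior (afterRight i j) [] rewrite columns j with suc (suc j) ∈ᵇ V′
  ... | true = refl
  ... | false = refl
  markedFrom-interior (afterDown i j) (down ∷ w)
    rewrite rows i | markedFrom-interior (afterDown (suc i) j) w with suc i ∈ᵇ H′
  ... | true = refl
  ... | false = refl
  markedFrom-interior (afterDown i j) (right ∷ w) = markedFrom-interior (afterRight (suc i) j) w
  markedFrom-interior (afterRight i j) (down ∷ w) = cong ((i , suc (suc j)) ∷_) (markedFrom-interior (afterDown i (suc j)) w)
  markedFrom-interior (afterRight i j) (right ∷ w)
    rewrite columns j | markedFrom-interior (afterRight i (suc j)) w with suc (suc j) ∈ᵇ V′
  ... | true = refl
  ... | false = refl

  tailMarks-interior : ∀ i t → tailMarks H V i t ≡ tailMarks H′ V′ i t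
  tailMarks-interior i nothing = refl
  tailMarks-interior i (just u) = markedFrom-interior (afterRight i 0) u

+-rightComm : ∀ a b c → a + b + c ≡ a + c + b
+-rightComm = solve-∀

-- CORNERS is the weight with α = 1, β = 0 and CINDEX the one with α = 0, β = 1.
module Weights (α β : ℕ) where

  ν : ℕ × ℕ → ℕ
  ν (i , c) = α + β * (i + c)

  weight : List (ℕ × ℕ) → ℕ
  weight l = sum (map ν l)

  weight-++ : ∀ xs ys → weight (xs ++ ys) ≡ weight xs + weight ys
  weight-++ xs ys rewrite map-++ ν xs ys = sum-++ (map ν xs) (map ν ys)

  mark : Bool → ℕ × ℕ → ℕ
  mark true x = ν x
  mark false x = 0

  weight-consIf : ∀ b x xs → weight (consIf b x xs) ≡ mark b x + weight xs
  weight-consIf true x xs = refl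
  weight-consIf false x xs = refl

  weight-columnMarks-snoc : ∀ H c i r →
    weight (columnMarks H c i (suc r)) ≡ weight (columnMarks H c i r) + mark ((i + r) ∈ᵇ H) (i + r , c)
  weight-columnMarks-snoc H c i r = begin
    weight (columnMarks H c i (suc r))
      ≡⟨ cong weight (columnMarks-snoc H c i r) ⟩
    weight (columnMarks H c i r ++ consIf ((i + r) ∈ᵇ H) (i + r , c) [])
      ≡⟨ weight-++ (columnMarks H c i r) _ ⟩
    weight (columnMarks H c i r) + weight (consIf ((i + r) ∈ᵇ H) (i + r , c) [])
      ≡⟨ cong (weight (columnMarks H c i r) +_) (trans (weight-consIf ((i + r) ∈ᵇ H) _ []) (+-identityʳ _)) ⟩
    weight (columnMarks H c i r) + mark ((i + r) ∈ᵇ H) (i + r , c) ∎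
    where open ≡-Reasoning

  prefixWeight : List ℕ → Bool → ℕ → ℕ → ℕ
  prefixWeight H b s k = weight (prefixMarks H b k (s ∸ k))

  weight-prefixMarks : ∀ H b k j →
    weight (prefixMarks H b k j) ≡ weight (columnMarks H 0 0 k) + weight (cornerMarks H b k j)
  weight-prefixMarks H b k j = weight-++ (columnMarks H 0 0 k) (cornerMarks H b k j)

  prefixWeight-diagonal : ∀ H b s → prefixWeight H b s s ≡ weight (columnMarks H 0 0 s) + mark b (s , 1)
  prefixWeight-diagonal H b s rewrite n∸n≡0 s | weight-prefixMarks H b s 0 | weight-consIf b (s , 1) [] =
    cong (weight (columnMarks H 0 0 s) +_) (+-identityʳ (mark b (s , 1)))

  prefixWeight-turn : ∀ H b s → prefixWeight H b (suc s) s ≡ prefixWeight H b s s + mark (not b) (s , 1)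
  prefixWeight-turn H b s rewrite m+n∸n≡m 1 s | prefixWeight-diagonal H b s | weight-prefixMarks H b s 1 with b
  ... | true = sym (+-assoc (weight (columnMarks H 0 0 s)) (ν (s , 1)) 0)
  ... | false = rearrange (weight (columnMarks H 0 0 s)) (ν (s , 1))
    where
    rearrange : ∀ w v → w + (v + 0) ≡ w + 0 + v
    rearrange = solve-∀

  prefixWeight-extend : ∀ H b {s k} → k < s →
    prefixWeight H b (suc s) k ≡ prefixWeight H b s k + mark (s ∈ᵇ H) (s , 1)
  prefixWeight-extend H b {s} {k} k<s = begin
    weight (prefixMarks H b k (suc s ∸ k))
      ≡⟨ cong (λ i → weight (prefixMarks H b k i)) (trans (+-∸-assoc 1 (<⇒≤ k<s)) (cong suc s∸k≡1+j)) ⟩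
    weight (prefixMarks H b k (suc (suc j)))
      ≡⟨ weight-prefixMarks H b k (suc (suc j)) ⟩
    C + (ν (k , 1) + weight (columnMarks H 1 (suc k) (suc j)))
      ≡⟨ cong (λ x → C + (ν (k , 1) + x)) (weight-columnMarks-snoc H 1 (suc k) j) ⟩
    C + (ν (k , 1) + (weight (columnMarks H 1 (suc k) j) + mark ((suc k + j) ∈ᵇ H) (suc k + j , 1)))
      ≡⟨ regroup C (ν (k , 1)) _ _ ⟩
    C + (ν (k , 1) + weight (columnMarks H 1 (suc k) j)) + mark ((suc k + j) ∈ᵇ H) (suc k + j , 1)
      ≡⟨ cong₂ (λ x i → x + mark (i ∈ᵇ H) (i , 1)) (sym (weight-prefixMarks H b k (suc j))) k+1+j≡s ⟩
    weight (prefixMarks H b k (suc j)) + mark (s ∈ᵇ H) (s , 1)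
      ≡⟨ cong (λ i → weight (prefixMarks H b k i) + mark (s ∈ᵇ H) (s , 1)) (sym s∸k≡1+j) ⟩
    weight (prefixMarks H b k (s ∸ k)) + mark (s ∈ᵇ H) (s , 1) ∎
    where
    open ≡-Reasoning
    j C : ℕ
    j = s ∸ suc k
    C = weight (columnMarks H 0 0 k)
    s∸k≡1+j : s ∸ k ≡ suc j
    s∸k≡1+j = +-∸-assoc 1 k<s
    k+1+j≡s : suc k + j ≡ s
    k+1+j≡s = m+[n∸m]≡n k<s
    regroup : ∀ a b c d → a + (b + (c + d)) ≡ a + (b + c) + d
    regroup = solve-∀

module ShuffleInvariant (α β : ℕ) (H : List ℕ) (0∈H : (0 ∈ᵇ H) ≡ true) where
  open Weights α β

  H′ : List ℕ
  H′ = remove 0 H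

  -- The weight of the marks on the prefix D^k R D^(s ∸ k) under (H , V) resp. (H′ , V′).
  X Y : ℕ → ℕ → ℕ
  X = prefixWeight H true
  Y = prefixWeight H′ false

  σ : ℕ → ℕ → ℕ
  σ s = Inverse.to (shuffle H s)

  rows : ∀ i → (suc i ∈ᵇ H′) ≡ (suc i ∈ᵇ H)
  rows i = ∈ᵇ-remove-other {suc i} {0} H (λ ())

  ∉H′ : ∀ s → (s ∈ᵇ H) ≡ false → (s ∈ᵇ H′) ≡ false
  ∉H′ zero s∉H = ∈ᵇ-remove-self 0 H
  ∉H′ (suc s) s∉H = trans (rows s) s∉H

  column : ∀ t → weight (columnMarks H 0 0 (suc t)) ≡ α + weight (columnMarks H 0 1 t)
  column t rewrite 0∈H | *-zeroʳ β | +-identityʳ α = refl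

  column′ : ∀ t → weight (columnMarks H′ 0 0 (suc t)) ≡ weight (columnMarks H 0 1 t)
  column′ t rewrite ∈ᵇ-remove-self 0 H = cong weight (columnMarks-rows rows 0 0 t)

  X-extend : ∀ {s k} → k < s → X (suc s) k ≡ X s k + mark (s ∈ᵇ H) (s , 1)
  X-extend = prefixWeight-extend H true

  Y-extend : ∀ {s r} → r < s → Y (suc s) r ≡ Y s r + mark (s ∈ᵇ H) (s , 1)
  Y-extend {suc s} {r} r<s =
    trans (prefixWeight-extend H′ false r<s) (cong (λ b → Y (suc s) r + mark b (suc s , 1)) (rows s))

  X-turn : ∀ s → X (suc s) s ≡ X s s
  X-turn s = trans (prefixWeight-turn H true s) (+-identityʳ (X s s))

  Y-turn : ∀ s → Y (suc s) s ≡ Y s s + ν (s , 1)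
  Y-turn = prefixWeight-turn H′ false

  X-down : ∀ s → X (suc s) (suc s) ≡ X s s + mark (s ∈ᵇ H) (s , 0) + β
  X-down s rewrite prefixWeight-diagonal H true (suc s) | prefixWeight-diagonal H true s
                 | weight-columnMarks-snoc H 0 0 s =
    arithmetic (weight (columnMarks H 0 0 s)) (mark (s ∈ᵇ H) (s , 0)) α β s
    where
    arithmetic : ∀ w m α β s → w + m + (α + β * (suc s + 1)) ≡ w + (α + β * (s + 1)) + m + β
    arithmetic = solve-∀

  Y-down : ∀ s → Y (suc s) (suc s) ≡ Y s s + mark (s ∈ᵇ H′) (s , 0)
  Y-down s rewrite prefixWeight-diagonal H′ false (suc s) | prefixWeight-diagonal H′ false s
                 | weight-columnMarks-snoc H′ 0 0 s =
    arithmetic (weight (columnMarks H′ 0 0 s)) (mark (s ∈ᵇ H′) (s , 0))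
    where
    arithmetic : ∀ w m → w + m + 0 ≡ w + 0 + m
    arithmetic = solve-∀

  diagonal-∈ : ∀ s → (s ∈ᵇ H) ≡ true → Y (suc s) (suc s) + (α + β) ≡ X s s
  diagonal-∈ zero _ rewrite prefixWeight-diagonal H′ false 1 | column′ 0 = arithmetic α β
    where
    arithmetic : ∀ α β → 0 + 0 + (α + β) ≡ α + β * 1 + 0
    arithmetic = solve-∀
  diagonal-∈ (suc t) s∈H
    rewrite Y-down (suc t) | rows t | s∈H | prefixWeight-diagonal H′ false (suc t) | column′ t
          | prefixWeight-diagonal H true (suc t) | column t =
    arithmetic (weight (columnMarks H 0 1 t)) α β t
    where
    arithmetic : ∀ w α β t → w + 0 + (α + β * (suc t + 0)) + (α + β) ≡ α + w + (α + β * (suc t + 1))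
    arithmetic = solve-∀

  diagonal-∉ : ∀ s → (s ∈ᵇ H) ≡ false → Y (suc s) s + (α + β) ≡ X (suc s) (suc s)
  diagonal-∉ zero 0∉H = contradiction (trans (sym 0∈H) 0∉H) (λ ())
  diagonal-∉ (suc t) s∉H
    rewrite Y-turn (suc t) | X-down (suc t) | s∉H | prefixWeight-diagonal H′ false (suc t) | column′ t
          | prefixWeight-diagonal H true (suc t) | column t =
    arithmetic (weight (columnMarks H 0 1 t)) α β t
    where
    arithmetic : ∀ w α β t → w + 0 + (α + β * (suc t + 1)) + (α + β) ≡ α + w + (α + β * (suc t + 1)) + 0 + β
    arithmetic = solve-∀

  σ-bounded : ∀ s {k} → k ≤ s → σ s k ≤ s
  σ-bounded s = FixesAbove⇒bounded (shuffle H s) (shuffle-fixes H s) _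

  Y-grow-∈ : ∀ {s r} → (s ∈ᵇ H) ≡ true → r ≤ s → Y (suc s) r ≡ Y s r + ν (s , 1)
  Y-grow-∈ {s} {r} s∈H r≤s with m≤n⇒m<n∨m≡n r≤s
  ... | inj₁ r<s rewrite Y-extend r<s | s∈H = refl
  ... | inj₂ refl = Y-turn s

  X-grow-∉ : ∀ {s k} → (s ∈ᵇ H) ≡ false → k ≤ s → X (suc s) k ≡ X s k
  X-grow-∉ {s} {k} s∉H k≤s with m≤n⇒m<n∨m≡n k≤s
  ... | inj₁ k<s rewrite X-extend k<s | s∉H = +-identityʳ (X s k)
  ... | inj₂ refl = X-turn s

  data Position (s : ℕ) : ℕ → Set where
    below : ∀ {k} → k < s → Position s k
    at    : Position s s
    next  : Position s (suc s)

  position : ∀ {s k} → k ≤ suc s → Position s k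
  position {s} k≤1+s with m≤n⇒m<n∨m≡n k≤1+s
  ... | inj₂ refl = next
  ... | inj₁ (s≤s k≤s) with m≤n⇒m<n∨m≡n k≤s
  ...   | inj₁ k<s = below k<s
  ...   | inj₂ refl = at

  Invariant : ℕ → Set
  Invariant s = ∀ k → k ≤ s → Y s (σ s k) + (α + β) ≡ X s k

  step-∈ : ∀ s → (s ∈ᵇ H) ≡ true → Invariant s →
           ∀ k → k ≤ suc s → Y (suc s) (σ s (transposeSuc s k)) + (α + β) ≡ X (suc s) k
  step-∈ s s∈H ih k k≤1+s with position k≤1+s
  ... | below k<s rewrite transposeSuc-below k<s = begin
    Y (suc s) (σ s k) + (α + β)      ≡⟨ cong (_+ (α + β)) (Y-grow-∈ s∈H (σ-bounded s (<⇒≤ k<s))) ⟩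
    Y s (σ s k) + ν (s , 1) + (α + β) ≡⟨ +-rightComm (Y s (σ s k)) _ _ ⟩
    Y s (σ s k) + (α + β) + ν (s , 1) ≡⟨ cong (_+ ν (s , 1)) (ih k (<⇒≤ k<s)) ⟩
    X s k + ν (s , 1)                 ≡⟨ cong (λ b → X s k + mark b (s , 1)) (sym s∈H) ⟩
    X s k + mark (s ∈ᵇ H) (s , 1)     ≡⟨ sym (X-extend k<s) ⟩
    X (suc s) k                       ∎
    where open ≡-Reasoning
  ... | at rewrite transposeSuc-self s | shuffle-fixes H s (suc s) (n<1+n s) =
    trans (diagonal-∈ s s∈H) (sym (X-turn s))
  ... | next rewrite transposeSuc-suc s = begin
    Y (suc s) (σ s s) + (α + β)          ≡⟨ cong (_+ (α + β)) (Y-grow-∈ s∈H (σ-bounded s ≤-refl)) ⟩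
    Y s (σ s s) + ν (s , 1) + (α + β)    ≡⟨ +-rightComm (Y s (σ s s)) _ _ ⟩
    Y s (σ s s) + (α + β) + ν (s , 1)    ≡⟨ cong (_+ ν (s , 1)) (ih s ≤-refl) ⟩
    X s s + ν (s , 1)                    ≡⟨ arithmetic (X s s) α β s ⟩
    X s s + ν (s , 0) + β                ≡⟨ cong (λ b → X s s + mark b (s , 0) + β) (sym s∈H) ⟩
    X s s + mark (s ∈ᵇ H) (s , 0) + β    ≡⟨ sym (X-down s) ⟩
    X (suc s) (suc s)                    ∎
    where
    open ≡-Reasoning
    arithmetic : ∀ x α β s → x + (α + β * (s + 1)) ≡ x + (α + β * (s + 0)) + β
    arithmetic = solve-∀

  step-∉-unmoved : ∀ s → (s ∈ᵇ H) ≡ false → Invariant s →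
                   ∀ k → k ≤ s → Y (suc s) (transposeSuc s (σ s k)) + (α + β) ≡ X s k
  step-∉-unmoved s s∉H ih k k≤s with σ s k | σ-bounded s k≤s | ih k k≤s
  ... | r | r≤s | invariant with m≤n⇒m<n∨m≡n r≤s
  ...   | inj₁ r<s rewrite transposeSuc-below r<s | Y-extend r<s | s∉H | +-identityʳ (Y s r) = invariant
  ...   | inj₂ refl rewrite transposeSuc-self s | Y-down s | ∉H′ s s∉H | +-identityʳ (Y s s) = invariant

  step-∉ : ∀ s → (s ∈ᵇ H) ≡ false → Invariant s →
           ∀ k → k ≤ suc s → Y (suc s) (transposeSuc s (σ s k)) + (α + β) ≡ X (suc s) k
  step-∉ s s∉H ih k k≤1+s with position k≤1+s
  ... | below k<s = trans (step-∉-unmoved s s∉H ih k (<⇒≤ k<s)) (sym (X-grow-∉ {s} s∉H (<⇒≤ k<s)))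
  ... | at = trans (step-∉-unmoved s s∉H ih s ≤-refl) (sym (X-grow-∉ {s} s∉H ≤-refl))
  ... | next rewrite shuffle-fixes H s (suc s) (n<1+n s) | transposeSuc-suc s = diagonal-∉ s s∉H

  invariant : ∀ s → Invariant s
  invariant zero zero _ = arithmetic α β
    where
    arithmetic : ∀ α β → 0 + (α + β) ≡ α + β * 1 + 0
    arithmetic = solve-∀
  invariant (suc s) with s ∈ᵇ H in s∈?H
  ... | true = step-∈ s s∈?H (invariant s)
  ... | false = step-∉ s s∈?H (invariant s)

countRight-downs : ∀ k → countRight (downs k) ≡ 0
countRight-downs zero = refl
countRight-downs (suc k) = countRight-downs k

shuffleDiagonals : List ℕ → (ℕ × ℕ) ↔ (ℕ × ℕ)
shuffleDiagonals H = antidiagonal↔ (shuffle H) (shuffle-fixes H)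

pathReshape : ∀ {m n} → List ℕ → Path m n ↔ Path m n
pathReshape H = onPaths (reshape (shuffleDiagonals H))
  (reshape-counts (shuffleDiagonals H) (antidiagonal-sum (shuffle H) (shuffle-fixes H)))

module _ (α β : ℕ) (H V : List ℕ) (0∈H : (0 ∈ᵇ H) ≡ true) (1∈V : (1 ∈ᵇ V) ≡ true) where
  open Weights α β
  open ShuffleInvariant α β H 0∈H

  V′ : List ℕ
  V′ = remove 1 V

  columns : ∀ j → (suc (suc j) ∈ᵇ V′) ≡ (suc (suc j) ∈ᵇ V)
  columns j = ∈ᵇ-remove-other {suc (suc j)} {1} V (λ ())

  weight-word : ∀ k j t →
    weight (markedFrom H′ V′ 0 0 nothing (word (inj₂ (antidiagonal (shuffle H) (k , j) , t)))) + (α + β)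
    ≡ weight (markedFrom H V 0 0 nothing (word (inj₂ ((k , j) , t))))
  weight-word k j t = begin
    weight (markedFrom H′ V′ 0 0 nothing (word (inj₂ ((k′ , j′) , t)))) + (α + β)
      ≡⟨ cong (λ l → weight l + (α + β)) (markedFrom-word H′ V′ k′ j′ t) ⟩
    weight (prefixMarks H′ (1 ∈ᵇ V′) k′ j′ ++ tailMarks H′ V′ (k′ + j′) t) + (α + β)
      ≡⟨ cong₂ (λ b s → weight (prefixMarks H′ b k′ j′ ++ tailMarks H′ V′ s t) + (α + β))
               (∈ᵇ-remove-self 1 V) (antidiagonal-sum (shuffle H) (shuffle-fixes H) k j) ⟩
    weight (prefixMarks H′ false k′ j′ ++ tailMarks H′ V′ (k + j) t) + (α + β)
      ≡⟨ cong (λ l → weight (prefixMarks H′ false k′ j′ ++ l) + (α + β))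
              (tailMarks-interior rows columns (k + j) t) ⟩
    weight (prefixMarks H′ false k′ j′ ++ tail) + (α + β)
      ≡⟨ cong (_+ (α + β)) (weight-++ (prefixMarks H′ false k′ j′) tail) ⟩
    Y (k + j) k′ + weight tail + (α + β)
      ≡⟨ +-rightComm (Y (k + j) k′) _ _ ⟩
    Y (k + j) k′ + (α + β) + weight tail
      ≡⟨ cong (_+ weight tail) (invariant (k + j) k (m≤m+n k j)) ⟩
    weight (prefixMarks H true k (k + j ∸ k)) + weight tail
      ≡⟨ cong (λ i → weight (prefixMarks H true k i) + weight tail) (m+n∸m≡n k j) ⟩
    weight (prefixMarks H true k j) + weight tail
      ≡⟨ sym (weight-++ (prefixMarks H true k j) tail) ⟩
    weight (prefixMarks H true k j ++ tail)
      ≡⟨ cong (λ b → weight (prefixMarks H b k j ++ tail)) (sym 1∈V) ⟩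
    weight (prefixMarks H (1 ∈ᵇ V) k j ++ tail)
      ≡⟨ cong weight (sym (markedFrom-word H V k j t)) ⟩
    weight (markedFrom H V 0 0 nothing (word (inj₂ ((k , j) , t)))) ∎
    where
    open ≡-Reasoning
    k′ j′ : ℕ
    k′ = proj₁ (antidiagonal (shuffle H) (k , j))
    j′ = proj₂ (antidiagonal (shuffle H) (k , j))
    tail : List (ℕ × ℕ)
    tail = tailMarks H V (k + j) t

  weight-pathReshape : ∀ {m n} → 1 ≤ n → (p : Path m n) →
    weight (markedNodes H′ V′ (Inverse.to (pathReshape H) p)) + (α + β) ≡ weight (markedNodes H V p)
  weight-pathReshape 1≤n (w , _ , rights) with shape w | word-shape w
  ... | inj₁ k | refl = contradiction (subst (1 ≤_) (trans (sym rights) (countRight-downs k)) 1≤n) λ ()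
  ... | inj₂ ((k , j) , t) | refl = weight-word k j t

  statistic-pathReshape : (S : List (ℕ × ℕ) → ℕ) → (∀ l → S l ≡ weight l) →
    ∀ {m n} → 1 ≤ n → (p : Path m n) →
    S (markedNodes H′ V′ (Inverse.to (pathReshape H) p)) + (α + β) ≡ S (markedNodes H V p)
  statistic-pathReshape S S≗weight 1≤n p =
    trans (cong (_+ (α + β)) (S≗weight _)) (trans (weight-pathReshape 1≤n p) (sym (S≗weight _)))

length≡weight : ∀ l → length l ≡ Weights.weight 1 0 l
length≡weight [] = refl
length≡weight (x ∷ l) = cong suc (length≡weight l)

sum≡weight : (g : ℕ × ℕ → ℕ) → (∀ i j → g (i , j) ≡ i + j) →
             ∀ l → sum (map g l) ≡ Weights.weight 0 1 l
sum≡weight g g≗ [] = refl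
sum≡weight g g≗ ((i , j) ∷ l) = cong₂ _+_ (trans (g≗ i j) (sym (+-identityʳ (i + j)))) (sum≡weight g g≗ l)

lemma3 : (m n : ℕ) → 1 ≤ m → 1 ≤ n →
           (H V : List ℕ) → All (λ h → h < m) H → All (λ v → 1 ≤ v × v ≤ n) V →
           0 ∈ H → 1 ∈ V →
           Σ (Path m n ⤖ Path m n) (λ φ → ∀ (p : Path m n) →
             (CORNERS (remove 0 H) (remove 1 V) (Bijection.to φ p) + 1 ≡ CORNERS H V p)
             × (CINDEX (remove 0 H) (remove 1 V) (Bijection.to φ p) + 1 ≡ CINDEX H V p))
lemma3 m n _ 1≤n H V _ _ 0∈H 1∈V = ↔⇒⤖ (pathReshape H) , λ p →
    statistic-pathReshape 1 0 H V 0∈ᵇH 1∈ᵇV length length≡weight 1≤n p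
  , statistic-pathReshape 0 1 H V 0∈ᵇH 1∈ᵇV _ (sum≡weight _ (λ _ _ → refl)) 1≤n p
  where
  0∈ᵇH : (0 ∈ᵇ H) ≡ true
  0∈ᵇH = ∈ᵇ-complete 0∈H
  1∈ᵇV : (1 ∈ᵇ V) ≡ true
  1∈ᵇV = ∈ᵇ-complete 1∈V
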